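{- Let $G$ be a graph on $n$ vertices (without isolated vertices for the open-neighborhood statements). Then (i) $\chi_{ON}(G)\le ch_{ON}(G)\le \chi_{ON}(G)\ln n+1$; (ii) $\chi_{CN}(G)\le ch_{CN}(G)\le \chi_{CN}(G)\ln n+1$; (iii) $\chi^*_{ON}(G)\le ch^*_{ON}(G)\le \chi^*_{ON}(G)\ln n_1+1$, where $n_1$ is the minimum number of colored vertices over all CFON$^*$ colorings of $G$ that use only $\chi^*_{ON}(G)$ colors; (iv) $\chi^*_{CN}(G)\le ch^*_{CN}(G)\le \chi^*_{CN}(G)\ln n_1+1$, where $n_1$ is the minimum number of colored vertices over all CFCN$^*$ colorings of $G$ that use only $\chi^*_{CN}(G)$ colors.
   Context: $N_G(v)$ is the open neighborhood, $N_G[v]=N_G(v)\cup\{v\}$. A CFON$^*$ coloring of $G$ colors a subset $V'\subseteq V(G)$ so that every vertex $v$ has, in $N_G(v)\cap V'$, a vertex whose color is distinct from all other colors in $N_G(v)\cap V'$; if $V'=V(G)$ it is a CFON coloring. CFCN$^*$/CFCN colorings are the same with $N_G[v]$. $\chi_{ON},\chi^*_{ON},\chi_{CN},\chi^*_{CN}$ are the minimum numbers of colors in such colorings. The list versions: for a $k$-assignment $\mathcal{L}=\{L_v\}$ ($|L_v|=k$), require the color of each colored vertex $v$ to lie in $L_v$; $ch_{ON}(G)$, $ch^*_{ON}(G)$, $ch_{CN}(G)$, $ch^*_{CN}(G)$ are the minimum $k$ such that for every $k$-assignment a corresponding list coloring exists. $\ln$ is the natural logarithm. -}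

module Defs where

open import Data.Nat using (ℕ; zero; suc; _+_; _*_; _^_; _≤_; _∸_)
open import Data.Nat using (_!)
open import Data.Fin using (Fin; _≟_)
open import Data.Bool using (Bool; true; false; _∨_; if_then_else_)
open import Data.Maybe using (Maybe; just; nothing; is-just)
open import Data.List using (List; length; filterᵇ)
open import Data.List.Relation.Unary.Unique.Propositional using (Unique)
open import Data.List.Membership.Propositional using (_∈_)
open import Data.List using (allFin)
open import Data.Product using (Σ; ∃; _×_; _,_)
open import Data.Unit using (⊤)
open import Relation.Nullary using (¬_; does)
open import Relation.Binary.PropositionalEquality using (_≡_; _≢_)

record Graph (n : ℕ) : Set where
  field
    adj    : Fin n → Fin n → Bool
    sym    : ∀ u v → adj u v ≡ adj v u
    irrefl : ∀ v → adj v v ≡ false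
open Graph public

openN : ∀ {n} → Graph n → Fin n → Fin n → Bool
openN G v u = adj G v u

closedN : ∀ {n} → Graph n → Fin n → Fin n → Bool
closedN G v u = adj G v u ∨ does (v ≟ u)

NoIsolated : ∀ {n} → Graph n → Set
NoIsolated {n} G = ∀ v → ∃ λ (u : Fin n) → adj G v u ≡ true

ConflictFree : ∀ {n} {C : Set} → (Fin n → Fin n → Bool) → (Fin n → Maybe C) → Set
ConflictFree {n} {C} N c =
  ∀ v → ∃ λ (u : Fin n) → N v u ≡ true × Σ C λ x → c u ≡ just x ×
        (∀ w → N v w ≡ true → w ≢ u → c w ≢ just x)

-- total = true: every vertex must be coloured (CFON / CFCN);
-- total = false: a subset may be coloured (CFON* / CFCN*).
TotalIf : ∀ {n} {C : Set} → Bool → (Fin n → Maybe C) → Set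
TotalIf {n} total c = if total then (∀ (v : Fin n) → c v ≢ nothing) else ⊤

Colorable : ∀ {n} → (Fin n → Fin n → Bool) → Bool → ℕ → Set
Colorable {n} N total k =
  ∃ λ (c : Fin n → Maybe (Fin k)) → ConflictFree N c × TotalIf total c

Choosable : ∀ {n} → (Fin n → Fin n → Bool) → Bool → ℕ → Set
Choosable {n} N total k =
  ∀ (L : Fin n → List ℕ) → (∀ v → length (L v) ≡ k) → (∀ v → Unique (L v)) →
  ∃ λ (c : Fin n → Maybe ℕ) → ConflictFree N c × TotalIf total c ×
      (∀ v x → c v ≡ just x → x ∈ L v)

colored : ∀ {n} {C : Set} → (Fin n → Maybe C) → ℕ
colored {n} c = length (filterᵇ (λ v → is-just (c v)) (allFin n))

ColoredCount : ∀ {n} → (Fin n → Fin n → Bool) → ℕ → ℕ → Set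
ColoredCount {n} N k m =
  ∃ λ (c : Fin n → Maybe (Fin k)) → ConflictFree N c × colored c ≡ m

IsMin : (ℕ → Set) → ℕ → Set
IsMin P m = P m × (∀ k → P k → m ≤ k)

-- expSum a k = k! * Σ_{j ≤ k} a^j / j!   (scaled partial sum of e^a)
expSum : ℕ → ℕ → ℕ
expSum a zero    = 1
expSum a (suc k) = suc k * expSum a k + a ^ suc k

-- LeMulLn a b m  encodes the real inequality  a ≤ b · ln m  (for m ≥ 1),
-- i.e. e^a ≤ m^b, i.e. every partial sum Σ_{j≤k} a^j/j! is ≤ m^b.
LeMulLn : ℕ → ℕ → ℕ → Set
LeMulLn a b m = ∀ k → expSum a k ≤ (m ^ b) * (k !)

{-# OPTIONS --safe #-}
module Submission where

-- Let c be a conflict-free colouring with q = m + 1 colours and N₀ coloured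
-- vertices, and let L assign k distinct colours to every vertex. For f : ℕ → Fin q,
-- recolour each coloured v by some y ∈ L v with f y = c v; the result is an
-- L-colouring, conflict-free because it refines c. A uniformly random f fails at v with
-- probability (m/q) ^ k, so a suitable f exists once N₀ m ^ k < q ^ k, and the method of
-- conditional expectations finds one. Hence if ch = k + 1 then (q/m) ^ k ≤ N₀, and
-- k ≤ q ln N₀ follows from e ^ (1/q) ≤ q/m, which on partial sums is a termwise
-- comparison of the series of e ^ k with the negative binomial series of (1 - 1/q) ^ (-q k).

open import Data.Bool using (Bool; true; false; if_then_else_)
open import Data.Bool.Properties using (if-float)
open import Data.Empty using (⊥-elim)
open import Data.Fin using (Fin; zero; suc; toℕ; fromℕ<)
import Data.Fin as Fin
open import Data.Fin.Properties using (toℕ-fromℕ<)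
open import Data.List using (List; []; _∷_; length; filter; filterᵇ; tabulate; allFin; upTo; concatMap)
open import Data.List.Properties
  using (length-filter; filter-accept; filter-reject; filter-all; length-tabulate; length-upTo)
import Data.List.Relation.Unary.All as All
open import Data.List.Relation.Unary.Any as Any using (Any; here; there; any?)
open import Data.List.Relation.Unary.AllPairs using (_∷_)
open import Data.List.Relation.Unary.Unique.Propositional using (Unique)
import Data.List.Relation.Unary.Unique.Propositional.Properties as Unique
open import Data.List.Relation.Binary.Subset.Propositional using (_⊆_)
open import Data.List.Membership.Propositional using (_∈_; _∉_; find; lose)
open import Data.List.Membership.Propositional.Properties
  using (∈-filter⁻; ∈-map⁺; ∈-concat⁺′; ∈-allFin; ∈-upTo⁻)
open import Data.Maybe as Maybe using (Maybe; just; nothing; is-just; maybe′; _>>=_)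
open import Data.Maybe.Relation.Unary.All as MaybeAll using (just; nothing)
open import Data.Nat
  using (ℕ; zero; suc; _+_; _*_; _^_; _∸_; _≤_; _<_; _<?_; _≟_; _!; NonZero; ≢-nonZero)
open import Data.Nat.Properties
open import Algebra.Properties.Semiring.Sum +-*-semiring
  using (sum; sum-syntax; sum-cong-≗; ∑-comm; *-distribˡ-sum; sum-remove)
open import Data.List.Membership.DecPropositional _≟_ using (_∈?_)
open import Data.Nat.Tactic.RingSolver using (solve-∀)
open import Data.Product using (∃; _×_; _,_; proj₁; proj₂)
open import Data.Unit using (tt)
open import Defs hiding (sym)
open import Function using (_∘_)
open import Relation.Binary.PropositionalEquality
  using (_≡_; _≢_; refl; sym; trans; cong; cong₂; subst; ≢-sym; module ≡-Reasoning)
open import Relation.Nullary using (¬_; yes; no; does; ¬?; contradiction)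
open import Relation.Nullary.Decidable using (dec-true; dec-false)

-- Exponential series against the negative binomial series

risingFactorial : ℕ → ℕ → ℕ
risingFactorial N zero    = 1
risingFactorial N (suc i) = N * risingFactorial (suc N) i

-- multichoose N i = (N + i - 1 choose i)
multichoose : ℕ → ℕ → ℕ
multichoose zero    zero    = 1
multichoose zero    (suc i) = 0
multichoose (suc N) zero    = 1
multichoose (suc N) (suc i) = multichoose N (suc i) + multichoose (suc N) i

-- negBinSum q N j = Σ_{i ≤ j} multichoose N i * q ^ (j - i), i.e. q ^ j times
-- a partial sum of the series (1 - 1/q) ^ -N = Σ_i multichoose N i * q ^ -i.
negBinSum : ℕ → ℕ → ℕ → ℕ
negBinSum q zero    j       = q ^ j
negBinSum q (suc N) zero    = 1
negBinSum q (suc N) (suc j) = negBinSum q N (suc j) + negBinSum q (suc N) j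

^-distribʳ-* : ∀ m n k → (m * n) ^ k ≡ m ^ k * n ^ k
^-distribʳ-* m n zero    = refl
^-distribʳ-* m n (suc k) = begin
  m * n * (m * n) ^ k     ≡⟨ cong (m * n *_) (^-distribʳ-* m n k) ⟩
  m * n * (m ^ k * n ^ k) ≡⟨ shuffle m n (m ^ k) (n ^ k) ⟩
  m * m ^ k * (n * n ^ k) ∎
  where
  open ≡-Reasoning
  shuffle : ∀ a b c d → a * b * (c * d) ≡ a * c * (b * d)
  shuffle = solve-∀

^-*-comm : ∀ m a b → (m ^ a) ^ b ≡ m ^ (b * a)
^-*-comm m a b = trans (^-*-assoc m a b) (cong (m ^_) (*-comm a b))

risingFactorial-suc : ∀ N i → risingFactorial N (suc i) ≡ risingFactorial N i * (N + i)
risingFactorial-suc N zero    = trans (*-identityʳ N) (sym (trans (*-identityˡ (N + 0)) (+-identityʳ N)))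
risingFactorial-suc N (suc i) = begin
  N * risingFactorial (suc N) (suc i)           ≡⟨ cong (N *_) (risingFactorial-suc (suc N) i) ⟩
  N * (risingFactorial (suc N) i * (suc N + i)) ≡⟨ *-assoc N _ _ ⟨
  N * risingFactorial (suc N) i * (suc N + i)   ≡⟨ cong (risingFactorial N (suc i) *_) (+-suc N i) ⟨
  risingFactorial N (suc i) * (N + suc i)       ∎
  where open ≡-Reasoning

k!*multichoose≡risingFactorial : ∀ N k → k ! * multichoose N k ≡ risingFactorial N k
k!*multichoose≡risingFactorial zero    zero    = refl
k!*multichoose≡risingFactorial zero    (suc k) = *-zeroʳ (suc k !)
k!*multichoose≡risingFactorial (suc N) zero    = refl
k!*multichoose≡risingFactorial (suc N) (suc k) = begin
  suc k ! * (multichoose N (suc k) + multichoose (suc N) k)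
    ≡⟨ *-distribˡ-+ (suc k !) (multichoose N (suc k)) _ ⟩
  suc k ! * multichoose N (suc k) + suc k * k ! * multichoose (suc N) k
    ≡⟨ cong (suc k ! * multichoose N (suc k) +_) (*-assoc (suc k) (k !) _) ⟩
  suc k ! * multichoose N (suc k) + suc k * (k ! * multichoose (suc N) k)
    ≡⟨ cong₂ _+_ (k!*multichoose≡risingFactorial N (suc k))
                 (cong (suc k *_) (k!*multichoose≡risingFactorial (suc N) k)) ⟩
  N * R + suc k * R
    ≡⟨ *-distribʳ-+ R N (suc k) ⟨
  (N + suc k) * R
    ≡⟨ *-comm (N + suc k) R ⟩
  R * (N + suc k)
    ≡⟨ cong (R *_) (+-suc N k) ⟩
  R * (suc N + k)
    ≡⟨ risingFactorial-suc (suc N) k ⟨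
  risingFactorial (suc N) (suc k) ∎
  where
  open ≡-Reasoning
  R : ℕ
  R = risingFactorial (suc N) k

n^k≤risingFactorial : ∀ n k → n ^ k ≤ risingFactorial n k
n^k≤risingFactorial n zero    = ≤-refl
n^k≤risingFactorial n (suc k) =
  *-monoʳ-≤ n (≤-trans (^-monoˡ-≤ k (n≤1+n n)) (n^k≤risingFactorial (suc n) k))

negBinSum-zero : ∀ q N → negBinSum q N 0 ≡ 1
negBinSum-zero q zero    = refl
negBinSum-zero q (suc N) = refl

negBinSum-suc : ∀ q N j → negBinSum q N (suc j) ≡ q * negBinSum q N j + multichoose N (suc j)
negBinSum-suc q zero    j       = sym (+-identityʳ _)
negBinSum-suc q (suc N) zero    = begin
  negBinSum q N 1 + 1                        ≡⟨ cong (_+ 1) (negBinSum-suc q N 0) ⟩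
  q * negBinSum q N 0 + multichoose N 1 + 1
    ≡⟨ cong (λ b → q * b + multichoose N 1 + 1) (negBinSum-zero q N) ⟩
  q * 1 + multichoose N 1 + 1                ≡⟨ +-assoc (q * 1) _ 1 ⟩
  q * 1 + (multichoose N 1 + 1)              ∎
  where open ≡-Reasoning
negBinSum-suc q (suc N) (suc j) = begin
  negBinSum q N (suc (suc j)) + negBinSum q (suc N) (suc j)
    ≡⟨ cong₂ _+_ (negBinSum-suc q N (suc j)) (negBinSum-suc q (suc N) j) ⟩
  (q * negBinSum q N (suc j) + multichoose N (suc (suc j)))
    + (q * negBinSum q (suc N) j + multichoose (suc N) (suc j))
    ≡⟨ regroup q _ _ _ _ ⟩
  q * (negBinSum q N (suc j) + negBinSum q (suc N) j)
    + (multichoose N (suc (suc j)) + multichoose (suc N) (suc j)) ∎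
  where
  open ≡-Reasoning
  regroup : ∀ q a b c d → (q * a + b) + (q * c + d) ≡ q * (a + c) + (b + d)
  regroup = solve-∀

-- Divided by (m + 1) ^ (N + j): a partial sum of the negative binomial distribution
-- with success probability m/(m + 1) is at most 1.
negBinSum-bound : ∀ m N j → m ^ N * negBinSum (suc m) N j ≤ suc m ^ (N + j)
negBinSum-bound m zero    j       = ≤-reflexive (+-identityʳ _)
negBinSum-bound m (suc N) zero    = begin
  m ^ suc N * 1     ≡⟨ *-identityʳ _ ⟩
  m ^ suc N         ≤⟨ ^-monoˡ-≤ (suc N) (n≤1+n m) ⟩
  suc m ^ suc N     ≡⟨ cong (suc m ^_) (+-identityʳ (suc N)) ⟨
  suc m ^ (suc N + 0) ∎
  where open ≤-Reasoning
negBinSum-bound m (suc N) (suc j) = begin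
  m ^ suc N * (negBinSum (suc m) N (suc j) + negBinSum (suc m) (suc N) j)
    ≡⟨ expand m (m ^ N) (negBinSum (suc m) N (suc j)) (negBinSum (suc m) (suc N) j) ⟩
  m * (m ^ N * negBinSum (suc m) N (suc j)) + m ^ suc N * negBinSum (suc m) (suc N) j
    ≤⟨ +-mono-≤ (*-monoʳ-≤ m (negBinSum-bound m N (suc j))) (negBinSum-bound m (suc N) j) ⟩
  m * Q + suc m ^ (suc N + j)
    ≡⟨ cong (λ e → m * Q + suc m ^ e) (+-suc N j) ⟨
  m * Q + Q
    ≡⟨ +-comm (m * Q) Q ⟩
  suc m ^ (suc N + suc j) ∎
  where
  open ≤-Reasoning
  Q : ℕ
  Q = suc m ^ (N + suc j)
  expand : ∀ m a b c → m * a * (b + c) ≡ m * (a * b) + m * a * c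
  expand = solve-∀

-- Termwise, a ^ i / i! = (q a) ^ i / (i! q ^ i) ≤ multichoose (q a) i / q ^ i.
expSum≤negBinSum : ∀ q a j → q ^ j * expSum a j ≤ j ! * negBinSum q (q * a) j
expSum≤negBinSum q a zero    = ≤-reflexive (sym (cong (1 *_) (negBinSum-zero q (q * a))))
expSum≤negBinSum q a (suc j) = begin
  q ^ suc j * expSum a (suc j)
    ≡⟨ expand q (q ^ j) (expSum a j) a (a ^ j) j ⟩
  suc j * q * (q ^ j * expSum a j) + q * a * (q ^ j * a ^ j)
    ≡⟨ cong (λ p → suc j * q * (q ^ j * expSum a j) + q * a * p) (^-distribʳ-* q a j) ⟨
  suc j * q * (q ^ j * expSum a j) + (q * a) ^ suc j
    ≤⟨ +-mono-≤ (*-monoʳ-≤ (suc j * q) (expSum≤negBinSum q a j))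
                (n^k≤risingFactorial N (suc j)) ⟩
  suc j * q * (j ! * negBinSum q N j) + risingFactorial N (suc j)
    ≡⟨ cong (suc j * q * (j ! * negBinSum q N j) +_) (k!*multichoose≡risingFactorial N (suc j)) ⟨
  suc j * q * (j ! * negBinSum q N j) + suc j ! * multichoose N (suc j)
    ≡⟨ collect (suc j) q (j !) (negBinSum q N j) (multichoose N (suc j)) ⟩
  suc j ! * (q * negBinSum q N j + multichoose N (suc j))
    ≡⟨ cong (suc j ! *_) (negBinSum-suc q N j) ⟨
  suc j ! * negBinSum q N (suc j) ∎
  where
  open ≤-Reasoning
  N : ℕ
  N = q * a
  expand : ∀ q qʲ e a aʲ j →
    q * qʲ * (suc j * e + a * aʲ) ≡ suc j * q * (qʲ * e) + q * a * (qʲ * aʲ)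
  expand = solve-∀
  collect : ∀ s q f b r → s * q * (f * b) + s * f * r ≡ s * f * (q * b + r)
  collect = solve-∀

expSum-bound : ∀ m a j → expSum a j * m ^ (suc m * a) ≤ j ! * suc m ^ (suc m * a)
expSum-bound m a j = *-cancelʳ-≤ _ _ (q ^ j) {{m^n≢0 q j}} (begin
  expSum a j * m ^ N * q ^ j          ≡⟨ shuffle (expSum a j) (m ^ N) (q ^ j) ⟩
  m ^ N * (q ^ j * expSum a j)        ≤⟨ *-monoʳ-≤ (m ^ N) (expSum≤negBinSum q a j) ⟩
  m ^ N * (j ! * negBinSum q N j)     ≡⟨ *-comm-middle (m ^ N) (j !) (negBinSum q N j) ⟩
  j ! * (m ^ N * negBinSum q N j)     ≤⟨ *-monoʳ-≤ (j !) (negBinSum-bound m N j) ⟩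
  j ! * q ^ (N + j)                   ≡⟨ cong (j ! *_) (^-distribˡ-+-* q N j) ⟩
  j ! * (q ^ N * q ^ j)               ≡⟨ *-assoc (j !) _ _ ⟨
  j ! * q ^ N * q ^ j                 ∎)
  where
  open ≤-Reasoning
  q : ℕ
  q = suc m
  N : ℕ
  N = q * a
  shuffle : ∀ e x y → e * x * y ≡ x * (y * e)
  shuffle = solve-∀
  *-comm-middle : ∀ x f b → x * (f * b) ≡ f * (x * b)
  *-comm-middle = solve-∀

LeMulLn-from-^ : ∀ m a N₀ → suc m ^ a ≤ N₀ * m ^ a → LeMulLn a (suc m) N₀
LeMulLn-from-^ m a N₀ q^a≤N₀m^a j =
  *-cancelʳ-≤ (expSum a j) (N₀ ^ q * j !) ((m ^ a) ^ q) {{m^n≢0 (m ^ a) q {{m^a≢0}}}} (begin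
    expSum a j * (m ^ a) ^ q      ≡⟨ cong (expSum a j *_) (^-*-comm m a q) ⟩
    expSum a j * m ^ (q * a)      ≤⟨ expSum-bound m a j ⟩
    j ! * q ^ (q * a)             ≡⟨ cong (j ! *_) (^-*-comm q a q) ⟨
    j ! * (q ^ a) ^ q             ≤⟨ *-monoʳ-≤ (j !) (^-monoˡ-≤ q q^a≤N₀m^a) ⟩
    j ! * (N₀ * m ^ a) ^ q        ≡⟨ cong (j ! *_) (^-distribʳ-* N₀ (m ^ a) q) ⟩
    j ! * (N₀ ^ q * (m ^ a) ^ q)  ≡⟨ reassoc (j !) (N₀ ^ q) ((m ^ a) ^ q) ⟩
    N₀ ^ q * j ! * (m ^ a) ^ q    ∎)
  where
  open ≤-Reasoning
  q : ℕ
  q = suc m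
  m^a≢0 : NonZero (m ^ a)
  m^a≢0 = ≢-nonZero λ m^a≡0 → <⇒≱ (m^n>0 q a)
    (≤-trans q^a≤N₀m^a (≤-reflexive (trans (cong (N₀ *_) m^a≡0) (*-zeroʳ N₀))))
  reassoc : ∀ f n x → f * (n * x) ≡ n * f * x
  reassoc = solve-∀

expSum-zero : ∀ j → expSum 0 j ≡ j !
expSum-zero zero    = refl
expSum-zero (suc j) = trans (+-identityʳ _) (cong (suc j *_) (expSum-zero j))

∑-const : ∀ k c → ∑[ i < k ] c ≡ k * c
∑-const zero    c = refl
∑-const (suc k) c = cong (c +_) (∑-const k c)

∑-except : ∀ k (t : Fin (suc k)) c → ∑[ i < suc k ] (if does (t Fin.≟ i) then 0 else c) ≡ k * c
∑-except k       zero    c = ∑-const k c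
∑-except (suc k) (suc t) c = cong (c +_) (∑-except k t c)

∑-indicator : ∀ {A : Set} {n} (p : A → Bool) (h : Fin n → A) a →
  ∑[ v < n ] (if p (h v) then a else 0) ≡ length (filterᵇ p (tabulate h)) * a
∑-indicator {n = zero}  p h a = refl
∑-indicator {n = suc n} p h a with p (h zero)
... | true  = cong (a +_) (∑-indicator p (h ∘ suc) a)
... | false = ∑-indicator p (h ∘ suc) a

term≤∑ : ∀ {k} (g : Fin k → ℕ) i → g i ≤ ∑[ j < k ] g j
term≤∑ {suc k} g i = ≤-trans (m≤m+n (g i) _) (≤-reflexive (sym (sum-remove {i = i} g)))

pigeonhole-∑ : ∀ {k} (g : Fin k → ℕ) B → ∑[ i < k ] g i < k * B → ∃ λ i → g i < B
pigeonhole-∑ {suc k} g B ∑g<kB with g zero <? B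
... | yes g₀<B = zero , g₀<B
... | no  g₀≮B =
  let i , gᵢ<B = pigeonhole-∑ (g ∘ suc) B
                   (+-cancelˡ-< B _ _ (≤-<-trans (+-monoˡ-≤ _ (≮⇒≥ g₀≮B)) ∑g<kB))
  in suc i , gᵢ<B

remove : ℕ → List ℕ → List ℕ
remove x = filter (λ y → ¬? (y ≟ x))

remove-⊆ : ∀ {x ℓ} → remove x ℓ ⊆ ℓ
remove-⊆ {x} {ℓ} = proj₁ ∘ ∈-filter⁻ (λ y → ¬? (y ≟ x)) {xs = ℓ}

∉-remove : ∀ {x ℓ} → x ∉ remove x ℓ
∉-remove {x} {ℓ} x∈ = proj₂ (∈-filter⁻ (λ y → ¬? (y ≟ x)) {xs = ℓ} x∈) refl

length-remove : ∀ {x ℓ} → Unique ℓ → x ∈ ℓ → suc (length (remove x ℓ)) ≡ length ℓ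
length-remove {x} {_ ∷ ys} (x∉ys ∷ _) (here refl) = cong (suc ∘ length) (begin
  remove x (x ∷ ys) ≡⟨ filter-reject (λ y → ¬? (y ≟ x)) (λ x≢x → x≢x refl) ⟩
  remove x ys       ≡⟨ filter-all (λ y → ¬? (y ≟ x)) (All.map ≢-sym x∉ys) ⟩
  ys                ∎)
  where open ≡-Reasoning
length-remove {x} (y∉ys ∷ u) (there x∈ys) =
  trans (cong (suc ∘ length) (filter-accept (λ y → ¬? (y ≟ x)) (All.lookup y∉ys x∈ys)))
        (cong suc (length-remove u x∈ys))

⊆-∷⁻ : ∀ {x : ℕ} {U ℓ} → ℓ ⊆ x ∷ U → x ∉ ℓ → ℓ ⊆ U
⊆-∷⁻ ℓ⊆x∷U x∉ℓ y∈ℓ = Any.tail (λ { refl → x∉ℓ y∈ℓ }) (ℓ⊆x∷U y∈ℓ)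

update : {A : Set} → (ℕ → A) → ℕ → A → ℕ → A
update f x i y = if does (y ≟ x) then i else f y

update-≡ : ∀ {A : Set} (f : ℕ → A) x i → update f x i x ≡ i
update-≡ f x i = cong (if_then i else f x) (dec-true (x ≟ x) refl)

update-≢ : ∀ {A : Set} (f : ℕ → A) {x} i {y} → y ≢ x → update f x i y ≡ f y
update-≢ f {x} i {y} y≢x = cong (if_then i else f y) (dec-false (y ≟ x) y≢x)

Any-update : ∀ {A : Set} {f : ℕ → A} {x i t ℓ′ ℓ} → ℓ′ ⊆ ℓ → x ∉ ℓ′ →
  Any (λ y → f y ≡ t) ℓ′ → Any (λ y → update f x i y ≡ t) ℓ
Any-update {f = f} {i = i} ℓ′⊆ℓ x∉ℓ′ hit with y , y∈ℓ′ , fy≡t ← find hit =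
  lose (ℓ′⊆ℓ y∈ℓ′) (trans (update-≢ f i λ { refl → x∉ℓ′ y∈ℓ′ }) fy≡t)

-- Conditional expectations

module ConditionalExpectation (m K : ℕ) where

  q : ℕ
  q = suc m

  record Constraint : Set where
    constructor constraint
    field
      options : List ℕ
      target  : Fin q
      misses  : ℕ

  Satisfied : (ℕ → Fin q) → Constraint → Set
  Satisfied f (constraint ℓ t _) = Any (λ y → f y ≡ t) ℓ

  -- q ^ (|ℓ| + s) times the probability that a uniformly random f misses t on ℓ
  weight : Constraint → ℕ
  weight (constraint ℓ _ s) = m ^ length ℓ * q ^ s

  weight? : Maybe Constraint → ℕ
  weight? = maybe′ weight 0

  Valid : List ℕ → Constraint → Set
  Valid U (constraint ℓ _ s) = Unique ℓ × ℓ ⊆ U × K ≤ length ℓ + s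

  potential : ∀ {n} → (Fin n → Maybe Constraint) → ℕ
  potential {n} cs = ∑[ v < n ] weight? (cs v)

  -- Conditioning on f x = i; nothing when this satisfies the constraint.
  fix : ℕ → Fin q → Constraint → Maybe Constraint
  fix x i (constraint ℓ t s) with x ∈? ℓ
  ... | no  _ = just (constraint ℓ t s)
  ... | yes _ = if does (t Fin.≟ i) then nothing else just (constraint (remove x ℓ) t (suc s))

  condition : ∀ {n} → ℕ → Fin q → (Fin n → Maybe Constraint) → Fin n → Maybe Constraint
  condition x i cs v = cs v >>= fix x i

  ∑-weight-condition : ∀ {x U} me → MaybeAll.All (Valid (x ∷ U)) me →
    ∑[ i < q ] weight? (me >>= fix x i) ≡ q * weight? me
  ∑-weight-condition nothing nothing = ∑-const q 0
  ∑-weight-condition {x} (just (constraint ℓ t s)) (just (u , _)) with x ∈? ℓ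
  ... | no  _   = ∑-const q (weight (constraint ℓ t s))
  ... | yes x∈ℓ = begin
    ∑[ i < q ] weight? (if does (t Fin.≟ i) then nothing else just e′)
      ≡⟨ sum-cong-≗ (λ i → if-float weight? (does (t Fin.≟ i)) {nothing} {just e′}) ⟩
    ∑[ i < q ] (if does (t Fin.≟ i) then 0 else m ^ length ℓ′ * q ^ suc s)
      ≡⟨ ∑-except m t _ ⟩
    m * (m ^ length ℓ′ * q ^ suc s)
      ≡⟨ shuffle m q (m ^ length ℓ′) (q ^ s) ⟩
    q * (m ^ suc (length ℓ′) * q ^ s)
      ≡⟨ cong (λ k → q * (m ^ k * q ^ s)) (length-remove u x∈ℓ) ⟩
    q * (m ^ length ℓ * q ^ s) ∎
    where
    open ≡-Reasoning
    ℓ′ : List ℕ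
    ℓ′ = remove x ℓ
    e′ : Constraint
    e′ = constraint ℓ′ t (suc s)
    shuffle : ∀ m q a b → m * (a * (q * b)) ≡ q * (m * a * b)
    shuffle = solve-∀

  potential-condition : ∀ {n x U} (cs : Fin n → Maybe Constraint) →
    (∀ v → MaybeAll.All (Valid (x ∷ U)) (cs v)) →
    ∑[ i < q ] potential (condition x i cs) ≡ q * potential cs
  potential-condition {n} {x} cs valid = begin
    ∑[ i < q ] ∑[ v < n ] weight? (cs v >>= fix x i)
      ≡⟨ ∑-comm (λ i v → weight? (cs v >>= fix x i)) ⟩
    ∑[ v < n ] ∑[ i < q ] weight? (cs v >>= fix x i)
      ≡⟨ sum-cong-≗ (λ v → ∑-weight-condition (cs v) (valid v)) ⟩
    ∑[ v < n ] (q * weight? (cs v))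
      ≡⟨ *-distribˡ-sum q (weight? ∘ cs) ⟨
    q * potential cs ∎
    where open ≡-Reasoning

  condition-valid : ∀ {x U} i me →
    MaybeAll.All (Valid (x ∷ U)) me → MaybeAll.All (Valid U) (me >>= fix x i)
  condition-valid i nothing nothing = nothing
  condition-valid {x} i (just (constraint ℓ t s)) (just (u , ℓ⊆x∷U , K≤)) with x ∈? ℓ
  ... | no x∉ℓ = just (u , ⊆-∷⁻ ℓ⊆x∷U x∉ℓ , K≤)
  ... | yes x∈ℓ with does (t Fin.≟ i)
  ...   | true  = nothing
  ...   | false =
    just (Unique.filter⁺ _ u , ⊆-∷⁻ (ℓ⊆x∷U ∘ remove-⊆ {x} {ℓ}) (∉-remove {x} {ℓ}) , K≤′)
    where
    K≤′ : K ≤ length (remove x ℓ) + suc s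
    K≤′ = ≤-trans K≤ (≤-reflexive (trans (cong (_+ s) (sym (length-remove u x∈ℓ)))
                                         (sym (+-suc _ s))))

  condition-satisfied : ∀ {f x} i me → MaybeAll.All (Satisfied f) (me >>= fix x i) →
    MaybeAll.All (Satisfied (update f x i)) me
  condition-satisfied i nothing _ = nothing
  condition-satisfied {f} {x} i (just (constraint ℓ t s)) sat with x ∈? ℓ
  ... | no x∉ℓ with just hit ← sat = just (Any-update (λ y∈ℓ → y∈ℓ) x∉ℓ hit)
  ... | yes x∈ℓ with t Fin.≟ i
  ...   | yes t≡i = just (lose x∈ℓ (trans (update-≡ f x i) (sym t≡i)))
  ...   | no  _ with just hit ← sat = just (Any-update (remove-⊆ {x} {ℓ}) (∉-remove {x} {ℓ}) hit)

  Valid-[]⇒heavy : ∀ {e} → Valid [] e → q ^ K ≤ weight e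
  Valid-[]⇒heavy {constraint []      _ s} (_ , _ , K≤s) =
    ≤-trans (^-monoʳ-≤ q K≤s) (≤-reflexive (sym (*-identityˡ (q ^ s))))
  Valid-[]⇒heavy {constraint (_ ∷ _) _ _} (_ , ℓ⊆[] , _) with () ← ℓ⊆[] (here refl)

  -- Fix the elements of U one by one, each time to a value keeping the potential below q ^ K.
  hitting : ∀ {n} U (cs : Fin n → Maybe Constraint) → (∀ v → MaybeAll.All (Valid U) (cs v)) →
    potential cs < q ^ K → ∃ λ f → ∀ v → MaybeAll.All (Satisfied f) (cs v)
  hitting [] cs valid small =
    (λ _ → zero) , λ v → absent (valid v) (≤-<-trans (term≤∑ (weight? ∘ cs) v) small)
    where
    absent : ∀ {me} → MaybeAll.All (Valid []) me → weight? me < q ^ K →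
      MaybeAll.All (Satisfied (λ _ → zero)) me
    absent nothing   _     = nothing
    absent (just {e} ve) light = ⊥-elim (<⇒≱ light (Valid-[]⇒heavy {e} ve))
  hitting (x ∷ U) cs valid small =
    let i , smallᵢ = pigeonhole-∑ (λ i → potential (condition x i cs)) (q ^ K)
                       (subst (_< q * q ^ K) (sym (potential-condition cs valid)) (*-monoʳ-< q small))
        f , sat = hitting U (condition x i cs) (λ v → condition-valid i (cs v) (valid v)) smallᵢ
    in update f x i , λ v → condition-satisfied i (cs v) (sat v)

  hitting-function : ∀ {n} (c : Fin n → Maybe (Fin q)) (L : Fin n → List ℕ) →
    (∀ v → length (L v) ≡ K) → (∀ v → Unique (L v)) → colored c * m ^ K < q ^ K →
    ∃ λ f → ∀ v {t} → c v ≡ just t → Any (λ y → f y ≡ t) (L v)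
  hitting-function {n} c L |L|≡K unique small =
    let f , sat = hitting U cs valid (subst (_< q ^ K) (sym potential≡) small)
    in f , λ v cv≡t →
         MaybeAll.drop-just (subst (MaybeAll.All (Satisfied f)) (cong (Maybe.map (initial v)) cv≡t) (sat v))
    where
    initial : Fin n → Fin q → Constraint
    initial v t = constraint (L v) t 0
    cs : Fin n → Maybe Constraint
    cs v = Maybe.map (initial v) (c v)
    U : List ℕ
    U = concatMap L (allFin n)
    valid : ∀ v → MaybeAll.All (Valid U) (cs v)
    valid v with c v
    ... | nothing = nothing
    ... | just _  = just (unique v , (λ y∈ → ∈-concat⁺′ y∈ (∈-map⁺ L (∈-allFin v))) ,
                          ≤-reflexive (sym (trans (+-identityʳ _) (|L|≡K v))))
    weight?-initial : ∀ v → weight? (cs v) ≡ (if is-just (c v) then m ^ K else 0)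
    weight?-initial v with c v
    ... | nothing = refl
    ... | just _  = trans (*-identityʳ _) (cong (m ^_) (|L|≡K v))
    potential≡ : potential cs ≡ colored c * m ^ K
    potential≡ =
      trans (sum-cong-≗ weight?-initial) (∑-indicator (λ v → is-just (c v)) (λ v → v) (m ^ K))

map-just⁻ : ∀ {A B : Set} {h : B → A} mb {a} →
  Maybe.map h mb ≡ just a → ∃ λ b → mb ≡ just b × h b ≡ a
map-just⁻ (just b) refl = b , refl , refl

>>=-just⁻ : ∀ {A B : Set} (ma : Maybe A) {g : A → Maybe B} {b} →
  (ma >>= g) ≡ just b → ∃ λ a → g a ≡ just b
>>=-just⁻ (just a) eq = a , eq

>>=-factor : ∀ {n} {A B : Set} {h : B → A} (c : Fin n → Maybe A) (g : Fin n → A → Maybe B) →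
  (∀ v {a} → c v ≡ just a → Maybe.map h (g v a) ≡ just a) →
  ∀ v → c v ≡ Maybe.map h (c v >>= g v)
>>=-factor c g hg≡ v with c v in eq
... | nothing = refl
... | just a  = sym (hg≡ v eq)

ConflictFree-factor : ∀ {n} {A B : Set} {N : Fin n → Fin n → Bool}
  {c : Fin n → Maybe A} {c′ : Fin n → Maybe B} (h : B → A) → (∀ v → c v ≡ Maybe.map h (c′ v)) → ConflictFree N c → ConflictFree N c′
ConflictFree-factor {c′ = c′} h c≡ cf v with u , Nvu , x , cu≡x , unique ← cf v =
  let y , c′u≡y , hy≡x = map-just⁻ (c′ u) (trans (sym (c≡ u)) cu≡x)
  in u , Nvu , y , c′u≡y , λ w Nvw w≢u c′w≡y →
       unique w Nvw w≢u (trans (c≡ w) (trans (cong (Maybe.map h) c′w≡y) (cong just hy≡x)))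

TotalIf-factor : ∀ {n} {A B : Set} total {c : Fin n → Maybe A} {c′ : Fin n → Maybe B}
  (h : B → A) → (∀ v → c v ≡ Maybe.map h (c′ v)) → TotalIf total c → TotalIf total c′
TotalIf-factor true  h c≡ coloured v c′v≡nothing =
  coloured v (trans (c≡ v) (cong (Maybe.map h) c′v≡nothing))
TotalIf-factor false _ _  _                      = tt

-- Choosability and colourability

toFin : ∀ k → ℕ → Maybe (Fin k)
toFin k x with x <? k
... | yes x<k = just (fromℕ< x<k)
... | no  _   = nothing

toℕ-toFin : ∀ {k x} → x < k → Maybe.map toℕ (toFin k x) ≡ just x
toℕ-toFin {k} {x} x<k with x <? k
... | yes x<k′ = cong just (toℕ-fromℕ< x<k′)
... | no  x≮k  = contradiction x<k x≮k

choosable⇒colorable : ∀ {n} (N : Fin n → Fin n → Bool) total k →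
  Choosable N total k → Colorable N total k
choosable⇒colorable N total k choosable
  with c , cf , tot , c∈L ← choosable (λ _ → upTo k) (λ _ → length-upTo k) (λ _ → Unique.upTo⁺ k) =
  (λ v → c v >>= toFin k) , ConflictFree-factor toℕ c≡ cf , TotalIf-factor total toℕ c≡ tot
  where
  c≡ : ∀ v → c v ≡ Maybe.map toℕ (c v >>= toFin k)
  c≡ = >>=-factor c (λ _ → toFin k) (λ v c≡x → toℕ-toFin (∈-upTo⁻ (c∈L v _ c≡x)))

pick : ∀ {q} → (ℕ → Fin q) → List ℕ → Fin q → Maybe ℕ
pick f ℓ t with any? (λ y → f y Fin.≟ t) ℓ
... | yes hit = just (proj₁ (find hit))
... | no  _   = nothing

pick-hit : ∀ {q} {f : ℕ → Fin q} {ℓ t} →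
  Any (λ y → f y ≡ t) ℓ → Maybe.map f (pick f ℓ t) ≡ just t
pick-hit {f = f} {ℓ} {t} hit with any? (λ y → f y Fin.≟ t) ℓ
... | yes hit′ = cong just (proj₂ (proj₂ (find hit′)))
... | no  miss = contradiction hit miss

pick-∈ : ∀ {q} {f : ℕ → Fin q} {ℓ t y} → pick f ℓ t ≡ just y → y ∈ ℓ
pick-∈ {f = f} {ℓ} {t} eq with any? (λ y → f y Fin.≟ t) ℓ | eq
... | yes hit | refl = proj₁ (proj₂ (find hit))

coloring⇒choosable : ∀ {n} (N : Fin n → Fin n → Bool) total m K
  (c : Fin n → Maybe (Fin (suc m))) →
  ConflictFree N c → TotalIf total c → colored c * m ^ K < suc m ^ K → Choosable N total K
coloring⇒choosable {n} N total m K c cf tot small L |L|≡K unique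
  with f , hit ← ConditionalExpectation.hitting-function m K c L |L|≡K unique small =
  c′ , ConflictFree-factor f c≡ cf , TotalIf-factor total f c≡ tot ,
  λ v y c′v≡y → pick-∈ (proj₂ (>>=-just⁻ (c v) c′v≡y))
  where
  c′ : Fin n → Maybe ℕ
  c′ v = c v >>= pick f (L v)
  c≡ : ∀ v → c v ≡ Maybe.map f (c′ v)
  c≡ = >>=-factor c (λ v → pick f (L v)) (λ v c≡t → pick-hit (hit v c≡t))

colorable-zero⇒empty : ∀ {n} {N : Fin n → Fin n → Bool} {total} → Colorable N total 0 → ¬ Fin n
colorable-zero⇒empty (c , cf , _) v with cf v
... | _ , _ , () , _

empty⇒choosable : ∀ {n} (N : Fin n → Fin n → Bool) total k → ¬ Fin n → Choosable N total k
empty⇒choosable N total k ¬v _ _ _ =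
  (λ _ → nothing) , (λ v → ⊥-elim (¬v v)) , uncoloured total , λ v → ⊥-elim (¬v v)
  where
  uncoloured : ∀ total → TotalIf total (λ (_ : Fin _) → nothing {A = ℕ})
  uncoloured true  v = ⊥-elim (¬v v)
  uncoloured false   = tt

choice-number-upper-bound : ∀ {n} {N : Fin n → Fin n → Bool} {total χ ch} N₀ →
  IsMin (Colorable N total) χ → IsMin (Choosable N total) ch →
  (c : Fin n → Maybe (Fin χ)) → ConflictFree N c → TotalIf total c → colored c ≤ N₀ →
  LeMulLn (ch ∸ 1) χ N₀
choice-number-upper-bound {N = N} {total} {zero} N₀ (colorable , _) (_ , minimal) _ _ _ _ j
  rewrite n≤0⇒n≡0 (minimal 0 (empty⇒choosable N total 0 (colorable-zero⇒empty colorable))) =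
  ≤-reflexive (trans (expSum-zero j) (sym (*-identityˡ (j !))))
choice-number-upper-bound {N = N} {total} {suc m} {zero} N₀ (_ , minimal) (choosable , _) _ _ _ _ =
  contradiction (minimal 0 (choosable⇒colorable N total 0 choosable)) λ ()
choice-number-upper-bound {N = N} {total} {suc m} {suc K} N₀ _ (_ , minimal) c cf tot c≤N₀ =
  LeMulLn-from-^ m K N₀ (≤-trans (≮⇒≥ not-small) (*-monoˡ-≤ (m ^ K) c≤N₀))
  where
  not-small : ¬ colored c * m ^ K < suc m ^ K
  not-small small = <-irrefl refl (minimal K (coloring⇒choosable N total m K c cf tot small))

choice-number-bounds : ∀ {n} {N : Fin n → Fin n → Bool} {total χ ch} N₀ →
  IsMin (Colorable N total) χ → IsMin (Choosable N total) ch →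
  (c : Fin n → Maybe (Fin χ)) → ConflictFree N c → TotalIf total c → colored c ≤ N₀ →
  χ ≤ ch × LeMulLn (ch ∸ 1) χ N₀
choice-number-bounds {N = N} {total} {ch = ch} N₀ isMinχ isMinch c cf tot c≤N₀ =
  proj₂ isMinχ ch (choosable⇒colorable N total ch (proj₁ isMinch)) ,
  choice-number-upper-bound N₀ isMinχ isMinch c cf tot c≤N₀

colored≤n : ∀ {n} {C : Set} (c : Fin n → Maybe C) → colored c ≤ n
colored≤n {n} c = ≤-trans (length-filter _ (allFin n)) (≤-reflexive (length-tabulate (λ v → v)))

proposition2 : ∀ n (G : Graph n) →
    (NoIsolated G → ∀ χ ch →
       IsMin (Colorable (openN G) true) χ → IsMin (Choosable (openN G) true) ch →
       χ ≤ ch × LeMulLn (ch ∸ 1) χ n)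
    × (∀ χ ch →
       IsMin (Colorable (closedN G) true) χ → IsMin (Choosable (closedN G) true) ch →
       χ ≤ ch × LeMulLn (ch ∸ 1) χ n)
    × (NoIsolated G → ∀ χ ch n₁ →
       IsMin (Colorable (openN G) false) χ → IsMin (Choosable (openN G) false) ch →
       IsMin (ColoredCount (openN G) χ) n₁ →
       χ ≤ ch × LeMulLn (ch ∸ 1) χ n₁)
    × (∀ χ ch n₁ →
       IsMin (Colorable (closedN G) false) χ → IsMin (Choosable (closedN G) false) ch →
       IsMin (ColoredCount (closedN G) χ) n₁ →
       χ ≤ ch × LeMulLn (ch ∸ 1) χ n₁)
proposition2 n G =
    (λ _ χ ch isMinχ isMinch → let c , cf , tot = proj₁ isMinχ in
       choice-number-bounds n isMinχ isMinch c cf tot (colored≤n c))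
  , (λ χ ch isMinχ isMinch → let c , cf , tot = proj₁ isMinχ in
       choice-number-bounds n isMinχ isMinch c cf tot (colored≤n c))
  , (λ _ χ ch n₁ isMinχ isMinch isMinn₁ → let c , cf , c≡n₁ = proj₁ isMinn₁ in
       choice-number-bounds n₁ isMinχ isMinch c cf tt (≤-reflexive c≡n₁))
  , (λ χ ch n₁ isMinχ isMinch isMinn₁ → let c , cf , c≡n₁ = proj₁ isMinn₁ in
       choice-number-bounds n₁ isMinχ isMinch c cf tt (≤-reflexive c≡n₁))
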